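{- For any finite group $G$, the order superenhanced power graph of $G$ is equal to the order supercommuting graph of $G$.
   Context: For a finite group $G$: the enhanced power graph has vertex set $G$, with distinct $g,h$ adjacent iff $\langle g,h\rangle$ is cyclic; the commuting graph has vertex set $G$, with distinct $g,h$ adjacent iff $gh=hg$. Given a graph $\mathrm{A}$ on vertex set $G$ and an equivalence relation $\mathrm{B}$ on $G$ with class $[g]$ of $g$, the $\mathrm{B}$ super$\mathrm{A}$ graph has vertex set $G$, with distinct $g,h$ adjacent iff there exist $g'\in[g]$, $h'\in[h]$ that are equal or adjacent in $\mathrm{A}$. The "order super" graphs use $\mathrm{B}$: $g\sim h$ iff $o(g)=o(h)$, where $o(g)$ is the order of $g$. -}

module Defs where

open import Level using (Level; _⊔_)
open import Algebra.Bundles using (Group)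
open import Data.Nat using (ℕ; zero; suc; _<_)
open import Data.Integer using (ℤ; +_; -[1+_])
open import Data.Fin using (Fin)
open import Data.Product using (Σ; ∃; _×_; _,_)
open import Data.Sum using (_⊎_)
open import Relation.Nullary using (¬_)

IsFiniteGroup : ∀ {c ℓ} → Group c ℓ → Set (c ⊔ ℓ)
IsFiniteGroup G = Σ ℕ λ n → Σ (Fin n → Carrier) λ f → ∀ x → ∃ λ i → f i ≈ x
  where open Group G

module GroupNotions {c ℓ} (G : Group c ℓ) where
  open Group G

  pow : Carrier → ℕ → Carrier
  pow g zero    = ε
  pow g (suc n) = g ∙ pow g n

  zpow : Carrier → ℤ → Carrier
  zpow g (+ n)      = pow g n
  zpow g -[1+ n ]   = (pow g (suc n)) ⁻¹

  IsOrder : Carrier → ℕ → Set ℓ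
  IsOrder g n = (0 < n) × (pow g n ≈ ε) × (∀ m → 0 < m → m < n → ¬ (pow g m ≈ ε))

  SameOrder : Carrier → Carrier → Set ℓ
  SameOrder g h = ∃ λ n → IsOrder g n × IsOrder h n

  data In⟨_,_⟩ (g h : Carrier) : Carrier → Set (c ⊔ ℓ) where
    gen₁  : In⟨ g , h ⟩ g
    gen₂  : In⟨ g , h ⟩ h
    unit  : In⟨ g , h ⟩ ε
    mul   : ∀ {x y} → In⟨ g , h ⟩ x → In⟨ g , h ⟩ y → In⟨ g , h ⟩ (x ∙ y)
    inv   : ∀ {x} → In⟨ g , h ⟩ x → In⟨ g , h ⟩ (x ⁻¹)
    resp  : ∀ {x y} → x ≈ y → In⟨ g , h ⟩ x → In⟨ g , h ⟩ y

  Cyclic⟨_,_⟩ : Carrier → Carrier → Set (c ⊔ ℓ)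
  Cyclic⟨ g , h ⟩ = ∃ λ z → In⟨ g , h ⟩ z × (∀ x → In⟨ g , h ⟩ x → ∃ λ k → zpow z k ≈ x)

  EPAdj : Carrier → Carrier → Set (c ⊔ ℓ)
  EPAdj g h = ¬ (g ≈ h) × Cyclic⟨ g , h ⟩

  CommAdj : Carrier → Carrier → Set ℓ
  CommAdj g h = ¬ (g ≈ h) × (g ∙ h ≈ h ∙ g)

  OrderSuper : ∀ {a} → (Carrier → Carrier → Set a) → Carrier → Carrier → Set (c ⊔ ℓ ⊔ a)
  OrderSuper A g h =
    ¬ (g ≈ h) × (∃ λ g' → ∃ λ h' → SameOrder g g' × SameOrder h h' × (g' ≈ h' ⊎ A g' h'))

  OrderSuperEnhancedPowerAdj : Carrier → Carrier → Set (c ⊔ ℓ)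
  OrderSuperEnhancedPowerAdj = OrderSuper EPAdj

  OrderSuperCommutingAdj : Carrier → Carrier → Set (c ⊔ ℓ)
  OrderSuperCommutingAdj = OrderSuper CommAdj

-- If g and h commute with orders m and n, write lcm(m, n) = u v with u ∣ m, v ∣ n
-- coprime; then z = g^(m/u) h^(n/v) has order u v.  For m ≠ n the powers of z of
-- orders m and n are distinct and generate a cyclic group (generated by
-- z^gcd, by Bézout), so every commuting pair of elements can be traded for an
-- enhanced-power pair with the same orders; if m = n one element serves for both.
-- The converse holds because cyclic groups are abelian.
module Submission where

open import Defs
open import Algebra.Bundles using (Group)
open import Function.Bundles using (_⇔_; mk⇔)
open import Level using (_⊔_)
open import Data.Nat using (ℕ; zero; suc; _+_; _*_; _<_; z<s; _%_; _/_; _≟_; NonZero; >-nonZero; >-nonZero⁻¹)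
open import Data.Nat.Properties using (*-comm; *-suc; *-zeroʳ; <⇒≱; m*n≢0; m*n≢0⇒m≢0)
open import Data.Nat.DivMod using (m≡m%n+[m/n]*n; m%n<n)
open import Data.Nat.Divisibility using (_∣_; divides; quotient; ∣⇒≤; m%n≡0⇒n∣m; ∣-antisym; *-cancelˡ-∣)
open import Data.Nat.Coprimality using (Coprime; coprime-divisor) renaming (sym to coprime-sym)
open import Data.Nat.GCD using (module GCD; module Bézout)
import Data.Integer as ℤ
open import Data.Product using (∃; ∃₂; _×_; _,_; proj₁; proj₂)
open import Data.Sum using (_⊎_; inj₁; inj₂)
open import Relation.Nullary using (¬_; yes; no)
open import Relation.Nullary.Negation using (contradiction)
import Relation.Binary.PropositionalEquality as ≡

module Arithmetic where

  open import Data.Nat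
  open import Data.Nat.Properties
  open import Data.Nat.Divisibility
  open import Data.Nat.Primality using (Prime; prime⇒irreducible; prime⇒nonTrivial)
  open import Data.Nat.Primality.Factorisation using (factorise)
  open import Data.Nat.Induction using (<-wellFounded)
  open import Data.List using ([]; _∷_)
  open import Data.List.Relation.Unary.All using (_∷_)
  open import Induction.WellFounded using (Acc; acc)
  open import Relation.Binary.PropositionalEquality

  *-positiveʳ : ∀ a {b} → 0 < a * b → 0 < b
  *-positiveʳ a {b} 0<ab = >-nonZero⁻¹ b {{m*n≢0⇒n≢0 a {{>-nonZero 0<ab}}}}

  *-positiveˡ : ∀ a {b} → 0 < a * b → 0 < a
  *-positiveˡ a {b} 0<ab = >-nonZero⁻¹ a {{m*n≢0⇒m≢0 a {{>-nonZero 0<ab}}}}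

  ∃-prime-divisor : ∀ {m} → 1 < m → ∃ λ p → Prime p × p ∣ m
  ∃-prime-divisor {m} 1<m
    with factorise m {{>-nonZero (<-trans z<s 1<m)}}
  ... | record { factors = [] ; isFactorisation = m≡1 } = contradiction m≡1 (>⇒≢ 1<m)
  ... | record { factors = p ∷ ps ; isFactorisation = m≡p*ps ; factorsPrime = prime-p ∷ _ } =
    p , prime-p , ∣-trans (m∣m*n _) (∣-reflexive (sym m≡p*ps))

  prime⇒coprime-nondivisor : ∀ {p x} → Prime p → ¬ p ∣ x → Coprime p x
  prime⇒coprime-nondivisor prime-p p∤x (d∣p , d∣x) with prime⇒irreducible prime-p d∣p
  ... | inj₁ d≡1 = d≡1
  ... | inj₂ refl = contradiction d∣x p∤x

  coprime-*ˡ : ∀ {a b c} → Coprime a c → Coprime b c → Coprime (a * b) c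
  coprime-*ˡ {a} {b} a⊥c b⊥c {d} (d∣ab , d∣c) = a⊥c (d∣a , d∣c)
    where
    d∣a : d ∣ a
    d∣a = coprime-divisor (λ (e∣d , e∣b) → b⊥c (e∣b , ∣-trans e∣d d∣c))
                          (subst (d ∣_) (*-comm a b) d∣ab)

  coprime-^ˡ : ∀ {p x} → Coprime p x → ∀ k → Coprime (p ^ k) x
  coprime-^ˡ p⊥x zero    (d∣1 , _) = ∣1⇒≡1 d∣1
  coprime-^ˡ p⊥x (suc k) = coprime-*ˡ p⊥x (coprime-^ˡ p⊥x k)

  coprime⇒*-∣ : ∀ {u v j} → Coprime u v → u ∣ j → v ∣ j → u * v ∣ j
  coprime⇒*-∣ {u} {v} u⊥v (divides t refl) v∣tu =
    subst (u * v ∣_) (*-comm u t)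
      (*-monoʳ-∣ u (coprime-divisor (coprime-sym u⊥v) (subst (v ∣_) (*-comm t u) v∣tu)))

  ^-monoʳ-∣ : ∀ p {b a} → b ≤ a → p ^ b ∣ p ^ a
  ^-monoʳ-∣ p {b} {a} b≤a = divides (p ^ (a ∸ b)) (begin
    p ^ a                 ≡⟨ cong (p ^_) (m+[n∸m]≡n b≤a) ⟨
    p ^ (b + (a ∸ b))     ≡⟨ ^-distribˡ-+-* p b (a ∸ b) ⟩
    p ^ b * p ^ (a ∸ b)   ≡⟨ *-comm (p ^ b) _ ⟩
    p ^ (a ∸ b) * p ^ b   ∎)
    where open ≡-Reasoning

  p-adic-decomposition : ∀ {p} → 1 < p → ∀ {n} → 0 < n → ∃₂ λ k n′ → n ≡ p ^ k * n′ × ¬ p ∣ n′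
  p-adic-decomposition {p} 1<p = go (<-wellFounded _)
    where
    go : ∀ {n} → Acc _<_ n → 0 < n → ∃₂ λ k n′ → n ≡ p ^ k * n′ × ¬ p ∣ n′
    go {n} (acc rec) 0<n with p ∣? n
    ... | no p∤n = 0 , n , sym (+-identityʳ n) , p∤n
    ... | yes (divides q n≡q*p) with go (rec q<n) 0<q
      where
      0<q : 0 < q
      0<q = *-positiveˡ q (subst (0 <_) n≡q*p 0<n)
      q<n : q < n
      q<n = subst (q <_) (sym n≡q*p) (m<m*n q p {{>-nonZero 0<q}} 1<p)
    ... | k , n′ , q≡pᵏn′ , p∤n′ = suc k , n′ , n≡pᵏ⁺¹n′ , p∤n′
      where
      n≡pᵏ⁺¹n′ : n ≡ p ^ suc k * n′
      n≡pᵏ⁺¹n′ = begin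
        n                 ≡⟨ n≡q*p ⟩
        q * p             ≡⟨ *-comm q p ⟩
        p * q             ≡⟨ cong (p *_) q≡pᵏn′ ⟩
        p * (p ^ k * n′)  ≡⟨ *-assoc p (p ^ k) n′ ⟨
        p ^ suc k * n′    ∎
        where open ≡-Reasoning

  -- u * v is then lcm m n.
  record CoprimeSplit (m n : ℕ) : Set where
    constructor coprimeSplit
    field
      {u v}   : ℕ
      u∣m     : u ∣ m
      v∣n     : v ∣ n
      coprime : Coprime u v
      m∣u*v   : m ∣ u * v
      n∣u*v   : n ∣ u * v

  coprimeSplit-sym : ∀ {m n} → CoprimeSplit m n → CoprimeSplit n m
  coprimeSplit-sym {m} {n} (coprimeSplit {u} {v} u∣m v∣n u⊥v m∣uv n∣uv) =
    coprimeSplit v∣n u∣m (coprime-sym u⊥v)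
                 (subst (n ∣_) (*-comm u v) n∣uv) (subst (m ∣_) (*-comm u v) m∣uv)

  coprimeSplit-extend-≤ : ∀ {p m n α β} → Prime p → ¬ p ∣ n → β ≤ α →
                          CoprimeSplit m n → CoprimeSplit (p ^ α * m) (p ^ β * n)
  coprimeSplit-extend-≤ {p} {m} {n} {α} {β} prime-p p∤n β≤α (coprimeSplit {u} {v} u∣m v∣n u⊥v m∣uv n∣uv) =
    coprimeSplit (*-monoʳ-∣ (p ^ α) u∣m)
                 (∣-trans v∣n (n∣m*n (p ^ β)))
                 (coprime-*ˡ (coprime-^ˡ p⊥v α) u⊥v)
                 (subst (p ^ α * m ∣_) (sym (*-assoc (p ^ α) u v)) (*-monoʳ-∣ (p ^ α) m∣uv))
                 (subst (p ^ β * n ∣_) (sym (*-assoc (p ^ α) u v)) (*-pres-∣ (^-monoʳ-∣ p β≤α) n∣uv))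
    where
    p⊥v : Coprime p v
    p⊥v = prime⇒coprime-nondivisor prime-p (λ p∣v → p∤n (∣-trans p∣v v∣n))

  coprimeSplit-extend : ∀ {p m n} → Prime p → ¬ p ∣ m → ¬ p ∣ n → ∀ α β →
                        CoprimeSplit m n → CoprimeSplit (p ^ α * m) (p ^ β * n)
  coprimeSplit-extend prime-p p∤m p∤n α β split with ≤-total β α
  ... | inj₁ β≤α = coprimeSplit-extend-≤ prime-p p∤n β≤α split
  ... | inj₂ α≤β = coprimeSplit-sym (coprimeSplit-extend-≤ prime-p p∤m α≤β (coprimeSplit-sym split))

  coprime-split : ∀ {m n} → 0 < m → 0 < n → CoprimeSplit m n
  coprime-split = go (<-wellFounded _)
    where
    go : ∀ {m n} → Acc _<_ m → 0 < m → 0 < n → CoprimeSplit m n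
    go {1} _ _ _ = coprimeSplit ∣-refl ∣-refl (λ (d∣1 , _) → ∣1⇒≡1 d∣1) (1∣ _) (n∣m*n 1)
    go {m@(suc (suc _))} {n} (acc rec) 0<m 0<n with ∃-prime-divisor {m} (s<s z<s)
    ... | p , prime-p , p∣m
      with p-adic-decomposition 1<p 0<m | p-adic-decomposition 1<p 0<n
      where 1<p = nonTrivial⇒n>1 p {{prime⇒nonTrivial prime-p}}
    ... | α , m′ , m≡pᵅm′ , p∤m′ | β , n′ , n≡pᵝn′ , p∤n′ =
      subst₂ CoprimeSplit (sym m≡pᵅm′) (sym n≡pᵝn′)
        (coprimeSplit-extend prime-p p∤m′ p∤n′ α β (go (rec m′<m) 0<m′ 0<n′))
      where
      0<m′ = *-positiveʳ (p ^ α) (subst (0 <_) m≡pᵅm′ 0<m)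
      0<n′ = *-positiveʳ (p ^ β) (subst (0 <_) n≡pᵝn′ 0<n)
      m′<m : m′ < m
      m′<m = ≤∧≢⇒< (∣⇒≤ (divides (p ^ α) m≡pᵅm′)) (λ m′≡m → p∤m′ (subst (p ∣_) (sym m′≡m) p∣m))

module GroupNotionsProperties {c ℓ} (G : Group c ℓ) where

  open Group G
  open GroupNotions G
  open Arithmetic using (*-positiveʳ; coprime⇒*-∣; coprimeSplit; coprime-split)
  open import Algebra.Properties.Group G using (inverseʳ-unique; //-rightDividesʳ)
  open import Relation.Binary.Reasoning.Setoid setoid

  pow-cong : ∀ {x y} → x ≈ y → ∀ k → pow x k ≈ pow y k
  pow-cong x≈y zero    = refl
  pow-cong x≈y (suc k) = ∙-cong x≈y (pow-cong x≈y k)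

  pow-homo-+ : ∀ x i j → pow x (i + j) ≈ pow x i ∙ pow x j
  pow-homo-+ x zero    j = sym (identityˡ _)
  pow-homo-+ x (suc i) j = trans (∙-congˡ (pow-homo-+ x i j)) (sym (assoc _ _ _))

  pow-* : ∀ x i j → pow x (i * j) ≈ pow (pow x i) j
  pow-* x i zero    = reflexive (≡.cong (pow x) (*-zeroʳ i))
  pow-* x i (suc j) = begin
    pow x (i * suc j)          ≡⟨ ≡.cong (pow x) (*-suc i j) ⟩
    pow x (i + i * j)          ≈⟨ pow-homo-+ x i (i * j) ⟩
    pow x i ∙ pow x (i * j)    ≈⟨ ∙-congˡ (pow-* x i j) ⟩
    pow x i ∙ pow (pow x i) j  ∎

  pow-ε : ∀ k → pow ε k ≈ ε
  pow-ε zero    = refl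
  pow-ε (suc k) = trans (identityˡ _) (pow-ε k)

  pow-multiple-ε : ∀ x n → pow x n ≈ ε → ∀ k → pow x (n * k) ≈ ε
  pow-multiple-ε x n xⁿ≈ε k = trans (pow-* x n k) (trans (pow-cong xⁿ≈ε k) (pow-ε k))

  pow-⁻¹ : ∀ x L → pow x (suc L) ≈ ε → ∀ k → pow x k ⁻¹ ≈ pow x (k * L)
  pow-⁻¹ x L xᴸ⁺¹≈ε k = sym (inverseʳ-unique (pow x k) (pow x (k * L)) (begin
    pow x k ∙ pow x (k * L)  ≈⟨ pow-homo-+ x k (k * L) ⟨
    pow x (k + k * L)        ≡⟨ ≡.cong (pow x) (≡.trans (≡.sym (*-suc k L)) (*-comm k (suc L))) ⟩
    pow x (suc L * k)        ≈⟨ pow-multiple-ε x (suc L) xᴸ⁺¹≈ε k ⟩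
    ε                        ∎))

  Commute : Carrier → Carrier → Set ℓ
  Commute x y = x ∙ y ≈ y ∙ x

  commute-resp : ∀ {x x′ y y′} → x ≈ x′ → y ≈ y′ → Commute x y → Commute x′ y′
  commute-resp x≈x′ y≈y′ xy≈yx = trans (∙-cong (sym x≈x′) (sym y≈y′)) (trans xy≈yx (∙-cong y≈y′ x≈x′))

  commute-pow : ∀ {x y} → Commute x y → ∀ k → Commute (pow x k) y
  commute-pow {x} {y} xy≈yx zero    = trans (identityˡ y) (sym (identityʳ y))
  commute-pow {x} {y} xy≈yx (suc k) = begin
    x ∙ pow x k ∙ y    ≈⟨ assoc _ _ _ ⟩
    x ∙ (pow x k ∙ y)  ≈⟨ ∙-congˡ (commute-pow xy≈yx k) ⟩
    x ∙ (y ∙ pow x k)  ≈⟨ assoc _ _ _ ⟨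
    x ∙ y ∙ pow x k    ≈⟨ ∙-congʳ xy≈yx ⟩
    y ∙ x ∙ pow x k    ≈⟨ assoc _ _ _ ⟩
    y ∙ (x ∙ pow x k)  ∎

  commute-⁻¹ : ∀ {x y} → Commute x y → Commute (x ⁻¹) y
  commute-⁻¹ {x} {y} xy≈yx = begin
    x ⁻¹ ∙ y                ≈⟨ //-rightDividesʳ x (x ⁻¹ ∙ y) ⟨
    x ⁻¹ ∙ y ∙ x ∙ x ⁻¹     ≈⟨ ∙-congʳ (assoc _ _ _) ⟩
    x ⁻¹ ∙ (y ∙ x) ∙ x ⁻¹   ≈⟨ ∙-congʳ (∙-congˡ xy≈yx) ⟨
    x ⁻¹ ∙ (x ∙ y) ∙ x ⁻¹   ≈⟨ ∙-congʳ (assoc _ _ _) ⟨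
    x ⁻¹ ∙ x ∙ y ∙ x ⁻¹     ≈⟨ ∙-congʳ (∙-congʳ (inverseˡ x)) ⟩
    ε ∙ y ∙ x ⁻¹            ≈⟨ ∙-congʳ (identityˡ y) ⟩
    y ∙ x ⁻¹                ∎

  commute-zpow : ∀ {x y} → Commute x y → ∀ k → Commute (zpow x k) y
  commute-zpow xy≈yx (ℤ.+ n)    = commute-pow xy≈yx n
  commute-zpow xy≈yx ℤ.-[1+ n ] = commute-⁻¹ (commute-pow xy≈yx (suc n))

  pow-distrib-commute : ∀ {x y} → Commute x y → ∀ k → pow (x ∙ y) k ≈ pow x k ∙ pow y k
  pow-distrib-commute xy≈yx zero    = sym (identityˡ ε)
  pow-distrib-commute {x} {y} xy≈yx (suc k) = begin
    x ∙ y ∙ pow (x ∙ y) k            ≈⟨ ∙-congˡ (pow-distrib-commute xy≈yx k) ⟩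
    x ∙ y ∙ (pow x k ∙ pow y k)      ≈⟨ assoc _ _ _ ⟩
    x ∙ (y ∙ (pow x k ∙ pow y k))    ≈⟨ ∙-congˡ (assoc _ _ _) ⟨
    x ∙ (y ∙ pow x k ∙ pow y k)      ≈⟨ ∙-congˡ (∙-congʳ (commute-pow xy≈yx k)) ⟨
    x ∙ (pow x k ∙ y ∙ pow y k)      ≈⟨ ∙-congˡ (assoc _ _ _) ⟩
    x ∙ (pow x k ∙ (y ∙ pow y k))    ≈⟨ assoc _ _ _ ⟨
    x ∙ pow x k ∙ (y ∙ pow y k)      ∎

  IsOrder-resp : ∀ {x y n} → x ≈ y → IsOrder x n → IsOrder y n
  IsOrder-resp {n = n} x≈y (0<n , xⁿ≈ε , minimal) =
    0<n , trans (sym (pow-cong x≈y n)) xⁿ≈ε ,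
    λ m 0<m m<n yᵐ≈ε → minimal m 0<m m<n (trans (pow-cong x≈y m) yᵐ≈ε)

  order-∣ : ∀ {g n k} → IsOrder g n → pow g k ≈ ε → n ∣ k
  order-∣ {g} {n} {k} (0<n , gⁿ≈ε , minimal) gᵏ≈ε = remainder-zero {{>-nonZero 0<n}}
    where
    remainder-zero : {{_ : NonZero n}} → n ∣ k
    remainder-zero with k % n in k%n≡r
    ... | zero  = m%n≡0⇒n∣m k n k%n≡r
    ... | suc r = contradiction gʳ⁺¹≈ε (minimal (suc r) z<s (≡.subst (_< n) k%n≡r (m%n<n k n)))
      where
      gʳ⁺¹≈ε : pow g (suc r) ≈ ε
      gʳ⁺¹≈ε = begin
        pow g (suc r)                        ≡⟨ ≡.cong (pow g) k%n≡r ⟨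
        pow g (k % n)                        ≈⟨ identityʳ _ ⟨
        pow g (k % n) ∙ ε                    ≈⟨ ∙-congˡ (pow-multiple-ε g n gⁿ≈ε (k / n)) ⟨
        pow g (k % n) ∙ pow g (n * (k / n))  ≈⟨ pow-homo-+ g (k % n) (n * (k / n)) ⟨
        pow g (k % n + n * (k / n))          ≡⟨ ≡.cong (λ j → pow g (k % n + j)) (*-comm n (k / n)) ⟩
        pow g (k % n + k / n * n)            ≡⟨ ≡.cong (pow g) (m≡m%n+[m/n]*n k n) ⟨
        pow g k                              ≈⟨ gᵏ≈ε ⟩
        ε                                    ∎

  ∣⇒IsOrder : ∀ {g n} → 0 < n → pow g n ≈ ε → (∀ k → pow g k ≈ ε → n ∣ k) → IsOrder g n
  ∣⇒IsOrder 0<n gⁿ≈ε n∣ = 0<n , gⁿ≈ε , λ m 0<m m<n gᵐ≈ε → <⇒≱ m<n (∣⇒≤ {{>-nonZero 0<m}} (n∣ m gᵐ≈ε))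

  order-unique : ∀ {g m n} → IsOrder g m → IsOrder g n → m ≡.≡ n
  order-unique gᵐ gⁿ = ∣-antisym (order-∣ gᵐ (proj₁ (proj₂ gⁿ))) (order-∣ gⁿ (proj₁ (proj₂ gᵐ)))

  order-pow : ∀ {g n d} (d∣n : d ∣ n) → IsOrder g n → IsOrder (pow g (quotient d∣n)) d
  order-pow {g} {n} {d} (divides q n≡q*d) gⁿ@(0<n , gⁿ≈ε , _) =
    ∣⇒IsOrder 0<d gᑫᵈ≈ε d∣
    where
    0<d : 0 < d
    0<d = *-positiveʳ q (≡.subst (0 <_) n≡q*d 0<n)
    gᑫᵈ≈ε : pow (pow g q) d ≈ ε
    gᑫᵈ≈ε = trans (sym (pow-* g q d)) (trans (reflexive (≡.cong (pow g) (≡.sym n≡q*d))) gⁿ≈ε)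
    d∣ : ∀ k → pow (pow g q) k ≈ ε → d ∣ k
    d∣ k gᑫᵏ≈ε = *-cancelˡ-∣ q {{m*n≢0⇒m≢0 q {{>-nonZero (≡.subst (0 <_) n≡q*d 0<n)}}}}
      (≡.subst (_∣ q * k) n≡q*d (order-∣ gⁿ (trans (pow-* g q k) gᑫᵏ≈ε)))

  pow-∙≈ε⇒pow-*≈ε : ∀ {a b} → Commute a b → ∀ {k} v →
                    pow (a ∙ b) k ≈ ε → pow b v ≈ ε → pow a (v * k) ≈ ε
  pow-∙≈ε⇒pow-*≈ε {a} {b} ab≈ba {k} v abᵏ≈ε bᵛ≈ε = begin
    pow a (v * k)                  ≈⟨ identityʳ _ ⟨
    pow a (v * k) ∙ ε              ≈⟨ ∙-congˡ (pow-multiple-ε b v bᵛ≈ε k) ⟨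
    pow a (v * k) ∙ pow b (v * k)  ≈⟨ pow-distrib-commute ab≈ba (v * k) ⟨
    pow (a ∙ b) (v * k)            ≡⟨ ≡.cong (pow (a ∙ b)) (*-comm v k) ⟩
    pow (a ∙ b) (k * v)            ≈⟨ pow-multiple-ε (a ∙ b) k abᵏ≈ε v ⟩
    ε                              ∎

  order-∙-coprime : ∀ {a b u v} → Commute a b → IsOrder a u → IsOrder b v → Coprime u v →
                    IsOrder (a ∙ b) (u * v)
  order-∙-coprime {a} {b} {u} {v} ab≈ba aᵘ@(0<u , aᵘ≈ε , _) bᵛ@(0<v , bᵛ≈ε , _) u⊥v =
    ∣⇒IsOrder 0<uv abᵘᵛ≈ε uv∣
    where
    0<uv : 0 < u * v
    0<uv = >-nonZero⁻¹ (u * v) {{m*n≢0 u v {{>-nonZero 0<u}} {{>-nonZero 0<v}}}}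
    abᵘᵛ≈ε : pow (a ∙ b) (u * v) ≈ ε
    abᵘᵛ≈ε = begin
      pow (a ∙ b) (u * v)            ≈⟨ pow-distrib-commute ab≈ba (u * v) ⟩
      pow a (u * v) ∙ pow b (u * v)  ≡⟨ ≡.cong (λ j → pow a (u * v) ∙ pow b j) (*-comm u v) ⟩
      pow a (u * v) ∙ pow b (v * u)  ≈⟨ ∙-cong (pow-multiple-ε a u aᵘ≈ε v) (pow-multiple-ε b v bᵛ≈ε u) ⟩
      ε ∙ ε                          ≈⟨ identityˡ ε ⟩
      ε                              ∎
    uv∣ : ∀ k → pow (a ∙ b) k ≈ ε → u * v ∣ k
    uv∣ k abᵏ≈ε = coprime⇒*-∣ u⊥v
      (coprime-divisor u⊥v (order-∣ aᵘ (pow-∙≈ε⇒pow-*≈ε ab≈ba v abᵏ≈ε bᵛ≈ε)))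
      (coprime-divisor (coprime-sym u⊥v) (order-∣ bᵛ (pow-∙≈ε⇒pow-*≈ε (sym ab≈ba) u baᵏ≈ε aᵘ≈ε)))
      where
      baᵏ≈ε : pow (b ∙ a) k ≈ ε
      baᵏ≈ε = trans (pow-cong (sym ab≈ba) k) abᵏ≈ε

  PowerOf : Carrier → Carrier → Set ℓ
  PowerOf w x = ∃ λ k → pow w k ≈ x

  ⟨⟩-pow : ∀ {x y s} → In⟨ x , y ⟩ s → ∀ k → In⟨ x , y ⟩ (pow s k)
  ⟨⟩-pow s∈ zero    = unit
  ⟨⟩-pow s∈ (suc k) = mul s∈ (⟨⟩-pow s∈ k)

  module _ {w} L (wᴸ⁺¹≈ε : pow w (suc L) ≈ ε) {x y} (x∈ : PowerOf w x) (y∈ : PowerOf w y) where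

    ⟨⟩⊆PowerOf : ∀ {s} → In⟨ x , y ⟩ s → PowerOf w s
    ⟨⟩⊆PowerOf gen₁ = x∈
    ⟨⟩⊆PowerOf gen₂ = y∈
    ⟨⟩⊆PowerOf unit = 0 , refl
    ⟨⟩⊆PowerOf (mul s∈ t∈) with ⟨⟩⊆PowerOf s∈ | ⟨⟩⊆PowerOf t∈
    ... | i , wⁱ≈s | j , wʲ≈t = i + j , trans (pow-homo-+ w i j) (∙-cong wⁱ≈s wʲ≈t)
    ⟨⟩⊆PowerOf (inv s∈) with ⟨⟩⊆PowerOf s∈
    ... | k , wᵏ≈s = k * L , trans (sym (pow-⁻¹ w L wᴸ⁺¹≈ε k)) (⁻¹-cong wᵏ≈s)
    ⟨⟩⊆PowerOf (resp s≈t s∈) with ⟨⟩⊆PowerOf s∈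
    ... | k , wᵏ≈s = k , trans wᵏ≈s s≈t

  pow-∣ : ∀ z {d N} → d ∣ N → PowerOf (pow z d) (pow z N)
  pow-∣ z {d} (divides q N≡q*d) =
    q , trans (sym (pow-* z d q)) (reflexive (≡.cong (pow z) (≡.trans (*-comm d q) (≡.sym N≡q*d))))

  bezout-pow : ∀ z d A B i j → d + j * B ≡.≡ i * A →
               pow z d ≈ pow (pow z A) i ∙ pow (pow z B) j ⁻¹
  bezout-pow z d A B i j d+jB≡iA = begin
    pow z d                                         ≈⟨ //-rightDividesʳ (pow z (B * j)) (pow z d) ⟨
    pow z d ∙ pow z (B * j) ∙ pow z (B * j) ⁻¹       ≈⟨ ∙-congʳ (pow-homo-+ z d (B * j)) ⟨
    pow z (d + B * j) ∙ pow z (B * j) ⁻¹            ≡⟨ ≡.cong (λ e → pow z e ∙ pow z (B * j) ⁻¹) d+Bj≡Ai ⟩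
    pow z (A * i) ∙ pow z (B * j) ⁻¹                ≈⟨ ∙-cong (pow-* z A i) (⁻¹-cong (pow-* z B j)) ⟩
    pow (pow z A) i ∙ pow (pow z B) j ⁻¹            ∎
    where
    d+Bj≡Ai : d + B * j ≡.≡ A * i
    d+Bj≡Ai = ≡.trans (≡.cong (d +_) (*-comm B j)) (≡.trans d+jB≡iA (*-comm i A))

  powers-cyclic : ∀ z {L} → 0 < L → pow z L ≈ ε → ∀ A B → Cyclic⟨ pow z A , pow z B ⟩
  powers-cyclic z {suc L} _ zᴸ⁺¹≈ε A B with Bézout.lemma A B
  ... | Bézout.result d gcd identity =
    w , w∈ identity , λ s s∈ → integral (⟨⟩⊆PowerOf L wᴸ⁺¹≈ε zᴬ∈ zᴮ∈ s∈)
    where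
    w = pow z d
    wᴸ⁺¹≈ε : pow w (suc L) ≈ ε
    wᴸ⁺¹≈ε = begin
      pow (pow z d) (suc L)  ≈⟨ pow-* z d (suc L) ⟨
      pow z (d * suc L)      ≡⟨ ≡.cong (pow z) (*-comm d (suc L)) ⟩
      pow z (suc L * d)      ≈⟨ pow-multiple-ε z (suc L) zᴸ⁺¹≈ε d ⟩
      ε                      ∎
    zᴬ∈ = pow-∣ z (proj₁ (GCD.commonDivisor gcd))
    zᴮ∈ = pow-∣ z (proj₂ (GCD.commonDivisor gcd))
    w∈ : Bézout.Identity d A B → In⟨ pow z A , pow z B ⟩ w
    w∈ (Bézout.+- i j eq) = resp (sym (bezout-pow z d A B i j eq)) (mul (⟨⟩-pow gen₁ i) (inv (⟨⟩-pow gen₂ j)))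
    w∈ (Bézout.-+ i j eq) = resp (sym (bezout-pow z d B A j i eq)) (mul (⟨⟩-pow gen₂ j) (inv (⟨⟩-pow gen₁ i)))
    integral : ∀ {s} → PowerOf w s → ∃ λ k → zpow w k ≈ s
    integral (k , wᵏ≈s) = ℤ.+ k , wᵏ≈s

  cyclic⇒commute : ∀ {g h} → Cyclic⟨ g , h ⟩ → Commute g h
  cyclic⇒commute (z , _ , every) with every _ gen₁ | every _ gen₂
  ... | i , zⁱ≈g | j , zʲ≈h = commute-resp zⁱ≈g zʲ≈h (commute-zpow (sym (commute-zpow refl j)) i)

  commute-pow₂ : ∀ {x y} → Commute x y → ∀ i j → Commute (pow x i) (pow y j)
  commute-pow₂ xy≈yx i j = sym (commute-pow (sym (commute-pow xy≈yx i)) j)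

  commute⇒order-common-multiple : ∀ {g h m n} → Commute g h → IsOrder g m → IsOrder h n →
                                  ∃₂ λ z L → IsOrder z L × m ∣ L × n ∣ L
  commute⇒order-common-multiple gh≈hg gᵐ@(0<m , _) hⁿ@(0<n , _)
    with coprime-split 0<m 0<n
  ... | coprimeSplit u∣m v∣n u⊥v m∣uv n∣uv =
    _ , _ , order-∙-coprime (commute-pow₂ gh≈hg (quotient u∣m) (quotient v∣n))
                            (order-pow u∣m gᵐ) (order-pow v∣n hⁿ) u⊥v ,
    m∣uv , n∣uv

  OrdersJoinedBy : ∀ {a} → (Carrier → Carrier → Set a) → ℕ → ℕ → Set (c ⊔ ℓ ⊔ a)
  OrdersJoinedBy A m n = ∃₂ λ x y → IsOrder x m × IsOrder y n × (x ≈ y ⊎ A x y)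

  commute⇒OrdersJoinedBy-EPAdj : ∀ {g h m n} → Commute g h → IsOrder g m → IsOrder h n →
                                 OrdersJoinedBy EPAdj m n
  commute⇒OrdersJoinedBy-EPAdj {g} {m = m} {n} gh≈hg gᵐ hⁿ with m ≟ n
  ... | yes ≡.refl = g , g , gᵐ , gᵐ , inj₁ refl
  ... | no m≢n with commute⇒order-common-multiple gh≈hg gᵐ hⁿ
  ... | z , L , zᴸ@(0<L , zᴸ≈ε , _) , m∣L , n∣L =
    x , y , xᵐ , yⁿ , inj₂ (x≉y , powers-cyclic z 0<L zᴸ≈ε (quotient m∣L) (quotient n∣L))
    where
    x = pow z (quotient m∣L)
    y = pow z (quotient n∣L)
    xᵐ = order-pow m∣L zᴸ
    yⁿ = order-pow n∣L zᴸ
    x≉y : ¬ x ≈ y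
    x≉y x≈y = m≢n (order-unique xᵐ (IsOrder-resp (sym x≈y) yⁿ))

  OrderSuper-transfer : ∀ {a b} {A : Carrier → Carrier → Set a} {B : Carrier → Carrier → Set b} →
                        (∀ {x y m n} → A x y → IsOrder x m → IsOrder y n → OrdersJoinedBy B m n) →
                        ∀ {g h} → OrderSuper A g h → OrderSuper B g h
  OrderSuper-transfer join (g≉h , g′ , h′ , g~g′ , h~h′ , inj₁ g′≈h′) =
    g≉h , g′ , h′ , g~g′ , h~h′ , inj₁ g′≈h′
  OrderSuper-transfer join (g≉h , g′ , h′ , (m , gᵐ , g′ᵐ) , (n , hⁿ , h′ⁿ) , inj₂ g′-h′)
    with join g′-h′ g′ᵐ h′ⁿ
  ... | x , y , xᵐ , yⁿ , x-y = g≉h , x , y , (m , gᵐ , xᵐ) , (n , hⁿ , yⁿ) , x-y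

  EPAdj⇒CommAdj : ∀ {x y} → EPAdj x y → CommAdj x y
  EPAdj⇒CommAdj (x≉y , cyclic) = x≉y , cyclic⇒commute cyclic

mainTheorem2 : ∀ {c ℓ} (G : Group c ℓ) → IsFiniteGroup G →
                 ∀ (g h : Group.Carrier G) →
                 GroupNotions.OrderSuperEnhancedPowerAdj G g h ⇔ GroupNotions.OrderSuperCommutingAdj G g h
mainTheorem2 G _ g h = mk⇔
  (OrderSuper-transfer λ adj xᵐ yⁿ → _ , _ , xᵐ , yⁿ , inj₂ (EPAdj⇒CommAdj adj))
  (OrderSuper-transfer λ (_ , xy≈yx) → commute⇒OrdersJoinedBy-EPAdj xy≈yx)
  where open GroupNotionsProperties G
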